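{- Let $k\geq 1$ and $n\geq 2k+1$ be integers. The gonality of the neighborhood geometry $\tilde{KG}(n,k)$ of the Kneser graph $KG(n,k)$ is $3$ when $n=2k+1$ and $2$ when $n\geq 2k+2$.
   Context: The Kneser graph $KG(n,k)$ has as vertices the $k$-subsets of $\{1,\ldots,n\}$, two being adjacent iff disjoint. For a graph $G$ with vertex set $G_0$, its neighborhood geometry $\tilde G$ has element set $G_0\times\{0\}\cup G_0\times\{1\}$ (elements of $G_0\times\{i\}$ have type $i$), with $(p,0)$ incident to $(q,1)$ iff $p$ and $q$ are adjacent in $G$. Its incidence graph is the bipartite graph on these elements whose edges are the incident pairs. The gonality of $\tilde G$ is half the girth of its incidence graph. -}

module Defs where

open import Data.Nat using (ℕ; zero; suc; _+_; _*_; _≤_)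
open import Data.Fin using (Fin; zero; suc; inject₁; fromℕ)
open import Data.Fin.Subset using (Subset; _∩_; ∣_∣; Empty)
open import Data.Product using (Σ; _×_; _,_)
open import Relation.Binary.PropositionalEquality using (_≡_)
open import Function.Definitions using (Injective)

record Graph : Set₁ where
  field
    V   : Set
    Adj : V → V → Set
open Graph public

record Cycle (G : Graph) (m : ℕ) : Set where
  field
    l       : ℕ
    len     : m ≡ suc l
    atLeast3 : 3 ≤ m
    c       : Fin (suc l) → V G
    inj     : Injective _≡_ _≡_ c
    step    : (i : Fin l) → Adj G (c (inject₁ i)) (c (suc i))
    close   : Adj G (c (fromℕ l)) (c zero)

HasGirth : Graph → ℕ → Set
HasGirth G g = Cycle G g × ((m : ℕ) → Cycle G m → g ≤ m)

KG : ℕ → ℕ → Graph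
KG n k = record
  { V   = Σ (Subset n) (λ p → ∣ p ∣ ≡ k)
  ; Adj = λ { (p , _) (q , _) → Empty (p ∩ q) } }

-- Incidence graph of the neighborhood geometry G~: elements G₀ × {0,1};
-- (p,0) incident to (q,1) iff p ~ q in G (symmetric, bipartite).
data IncAdj (G : Graph) : V G × Fin 2 → V G × Fin 2 → Set where
  inc01 : ∀ {p q} → Adj G p q → IncAdj G (p , zero) (q , suc zero)
  inc10 : ∀ {p q} → Adj G p q → IncAdj G (q , suc zero) (p , zero)

IncidenceGraph : Graph → Graph
IncidenceGraph G = record { V = V G × Fin 2 ; Adj = IncAdj G }

-- Gonality of G~ is γ: half the girth of its incidence graph, i.e. girth = 2γ.
HasGonality : Graph → ℕ → Set
HasGonality G γ = HasGirth (IncidenceGraph G) (2 * γ)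

-- Incidence flips the type, so the incidence graph is bipartite: its cycles have even
-- length, hence length ≥ 4. A 4-cycle is a pair of distinct k-sets a, b both disjoint from
-- a pair of distinct k-sets c, d; then a ∪ b and c ∪ d are disjoint and each has more
-- than k elements, which forces n ≥ 2k+2. Conversely, let S, T be disjoint (k-1)-sets
-- avoiding a few marker points. If n ≥ 2k+2 the sets {1}∪S, {3}∪T, {2}∪S, {4}∪T form a
-- 4-cycle, and if n ≥ 2k+1 the sets {1}∪S, {3}∪T, {2}∪S, {1}∪T, {3}∪S, {2}∪T form a 6-cycle.

module Submission where

open import Defs
open import Data.Nat using (ℕ; _+_; _*_; _≤_)
open import Data.Product using (_×_)
open import Relation.Binary.PropositionalEquality using (_≡_)

open import Data.Nat using (zero; suc; _<_; s≤s)
open import Data.Nat.Properties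
  using (module ≤-Reasoning; ≤-refl; m≤m+n; +-suc; +-mono-≤; +-cancelˡ-≤; ≡-irrelevant
        ; m≤n⇒∃[o]m+o≡n)
open import Data.Nat.Divisibility using (_∣_; divides; _∣0; ∣-refl; ∣m∣n⇒∣m+n)
open import Data.Nat.GeneralisedArithmetic using (fold)
open import Data.Nat.Tactic.RingSolver using (solve-∀)
open import Data.Bool using (true; false)
open import Data.Vec using ([]; _∷_; here; there)
open import Data.Fin using (Fin; zero; suc; inject₁; fromℕ; opposite)
open import Data.Fin.Patterns using (0F; 1F; 2F; 3F; 4F; 5F)
open import Data.Fin.Properties using (opposite-involutive)
open import Data.Fin.Subset using (Subset; outside; _∩_; _∪_; ∣_∣; Empty; ⊥)
open import Data.Fin.Subset.Properties
  using (∩-comm; drop-∷-Empty; ∉⊥; x∈p∩q⁺; x∈p∩q⁻; x∈p∪q⁻; ∣p∣≤n; ∣p∣≤∣p∪q∣; ∣q∣≤∣p∪q∣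
        ; ∣⊥∣≡0)
open import Data.Product using (Σ; _,_; proj₁; proj₂)
open import Data.Sum using (_⊎_; inj₁; inj₂; [_,_])
import Data.Sum as Sum
open import Data.Empty using (⊥-elim)
open import Relation.Nullary using (¬_)
open import Function.Base using (id)
open import Relation.Binary.PropositionalEquality
  using (_≢_; refl; sym; trans; cong; subst; module ≡-Reasoning)
open import Function.Consequences.Propositional
  using (inverseʳ⇒injective; strictlyInverseʳ⇒inverseʳ)

fold-opposite-fixed⇒even : ∀ m (t : Fin 2) → fold t opposite m ≡ t → 2 ∣ m
fold-opposite-fixed⇒even zero          t  _ = 2 ∣0
fold-opposite-fixed⇒even (suc zero)    0F ()
fold-opposite-fixed⇒even (suc zero)    1F ()
fold-opposite-fixed⇒even (suc (suc m)) t  e =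
  ∣m∣n⇒∣m+n ∣-refl
    (fold-opposite-fixed⇒even m t (trans (sym (opposite-involutive _)) e))

module _ {G : Graph} where

  IncAdj-sym : ∀ {x y} → IncAdj G x y → IncAdj G y x
  IncAdj-sym (inc01 a) = inc10 a
  IncAdj-sym (inc10 a) = inc01 a

  IncAdj-opposite : ∀ {x y} → IncAdj G x y → proj₂ y ≡ opposite (proj₂ x)
  IncAdj-opposite (inc01 _) = refl
  IncAdj-opposite (inc10 _) = refl

  IncAdj-IncAdj-same-type : ∀ {x y z} → IncAdj G x y → IncAdj G y z → proj₂ z ≡ proj₂ x
  IncAdj-IncAdj-same-type {x} {y} {z} xy yz = begin
    proj₂ z                        ≡⟨ IncAdj-opposite yz ⟩
    opposite (proj₂ y)             ≡⟨ cong opposite (IncAdj-opposite xy) ⟩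
    opposite (opposite (proj₂ x))  ≡⟨ opposite-involutive (proj₂ x) ⟩
    proj₂ x                        ∎
    where open ≡-Reasoning

  walk-type : ∀ l (w : Fin (suc l) → V G × Fin 2) →
              (∀ i → IncAdj G (w (inject₁ i)) (w (suc i))) →
              proj₂ (w (fromℕ l)) ≡ fold (proj₂ (w zero)) opposite l
  walk-type zero    w step = refl
  walk-type (suc l) w step =
    trans (IncAdj-opposite (step (fromℕ l)))
          (cong opposite (walk-type l (λ i → w (inject₁ i)) (λ i → step (inject₁ i))))

  incidence-cycle-even : ∀ {m} → Cycle (IncidenceGraph G) m → 2 ∣ m
  incidence-cycle-even record { l = l ; len = refl ; c = c ; step = step ; close = close } =
    fold-opposite-fixed⇒even (suc l) (proj₂ (c zero))
      (sym (trans (IncAdj-opposite close) (cong opposite (walk-type l c step))))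

  incidence-girth≥4 : ∀ {m} → Cycle (IncidenceGraph G) m → 4 ≤ m
  incidence-girth≥4 C with incidence-cycle-even C | Cycle.atLeast3 C
  ... | divides zero                refl | ()
  ... | divides (suc zero)          refl | s≤s (s≤s ())
  ... | divides (suc (suc q))       refl | _ = m≤m+n 4 _

  incidence-girth≥6 : ¬ Cycle (IncidenceGraph G) 4 → ∀ {m} → Cycle (IncidenceGraph G) m → 6 ≤ m
  incidence-girth≥6 no-square C with incidence-cycle-even C | Cycle.atLeast3 C
  ... | divides zero                refl | ()
  ... | divides (suc zero)          refl | s≤s (s≤s ())
  ... | divides (suc (suc zero))    refl | _ = ⊥-elim (no-square C)
  ... | divides (suc (suc (suc q))) refl | _ = m≤m+n 6 _

module _ {n : ℕ} where

  Empty-∷ : {p : Subset n} → Empty p → Empty (outside ∷ p)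
  Empty-∷ e (suc x , there x∈p) = e (x , x∈p)

  Empty-p∩[q∪r] : {p q r : Subset n} → Empty (p ∩ q) → Empty (p ∩ r) → Empty (p ∩ (q ∪ r))
  Empty-p∩[q∪r] {p} {q} {r} e f (x , x∈) with x∈p∩q⁻ p (q ∪ r) x∈
  ... | x∈p , x∈q∪r =
    [ (λ x∈q → e (x , x∈p∩q⁺ (x∈p , x∈q)))
    , (λ x∈r → f (x , x∈p∩q⁺ (x∈p , x∈r))) ] (x∈p∪q⁻ q r x∈q∪r)

  Empty-[p∪q]∩r : {p q r : Subset n} → Empty (p ∩ r) → Empty (q ∩ r) → Empty ((p ∪ q) ∩ r)
  Empty-[p∪q]∩r {p} {q} {r} e f (x , x∈) with x∈p∩q⁻ (p ∪ q) r x∈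
  ... | x∈p∪q , x∈r =
    [ (λ x∈p → e (x , x∈p∩q⁺ (x∈p , x∈r)))
    , (λ x∈q → f (x , x∈p∩q⁺ (x∈q , x∈r))) ] (x∈p∪q⁻ p q x∈p∪q)

Empty-∩⇒∣p∪q∣≡∣p∣+∣q∣ : ∀ {n} (p q : Subset n) → Empty (p ∩ q) → ∣ p ∪ q ∣ ≡ ∣ p ∣ + ∣ q ∣
Empty-∩⇒∣p∪q∣≡∣p∣+∣q∣ []          []          e = refl
Empty-∩⇒∣p∪q∣≡∣p∣+∣q∣ (true ∷ p)  (true ∷ q)  e = ⊥-elim (e (zero , here))
Empty-∩⇒∣p∪q∣≡∣p∣+∣q∣ (true ∷ p)  (false ∷ q) e =
  cong suc (Empty-∩⇒∣p∪q∣≡∣p∣+∣q∣ p q (drop-∷-Empty e))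
Empty-∩⇒∣p∪q∣≡∣p∣+∣q∣ (false ∷ p) (true ∷ q)  e =
  trans (cong suc (Empty-∩⇒∣p∪q∣≡∣p∣+∣q∣ p q (drop-∷-Empty e))) (sym (+-suc _ _))
Empty-∩⇒∣p∪q∣≡∣p∣+∣q∣ (false ∷ p) (false ∷ q) e = Empty-∩⇒∣p∪q∣≡∣p∣+∣q∣ p q (drop-∷-Empty e)

p≢q⇒∣p∣<∣p∪q∣⊎∣q∣<∣p∪q∣ : ∀ {n} (p q : Subset n) → p ≢ q → ∣ p ∣ < ∣ p ∪ q ∣ ⊎ ∣ q ∣ < ∣ p ∪ q ∣
p≢q⇒∣p∣<∣p∪q∣⊎∣q∣<∣p∪q∣ []          []          p≢q = ⊥-elim (p≢q refl)
p≢q⇒∣p∣<∣p∪q∣⊎∣q∣<∣p∪q∣ (true ∷ p)  (false ∷ q) _   = inj₂ (s≤s (∣q∣≤∣p∪q∣ p q))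
p≢q⇒∣p∣<∣p∪q∣⊎∣q∣<∣p∪q∣ (false ∷ p) (true ∷ q)  _   = inj₁ (s≤s (∣p∣≤∣p∪q∣ p q))
p≢q⇒∣p∣<∣p∪q∣⊎∣q∣<∣p∪q∣ (true ∷ p)  (true ∷ q)  p≢q =
  Sum.map s≤s s≤s (p≢q⇒∣p∣<∣p∪q∣⊎∣q∣<∣p∪q∣ p q (λ p≡q → p≢q (cong (true ∷_) p≡q)))
p≢q⇒∣p∣<∣p∪q∣⊎∣q∣<∣p∪q∣ (false ∷ p) (false ∷ q) p≢q =
  p≢q⇒∣p∣<∣p∪q∣⊎∣q∣<∣p∪q∣ p q (λ p≡q → p≢q (cong (false ∷_) p≡q))

p≢q⇒k<∣p∪q∣ : ∀ {n k} {p q : Subset n} → ∣ p ∣ ≡ k → ∣ q ∣ ≡ k → p ≢ q → k < ∣ p ∪ q ∣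
p≢q⇒k<∣p∪q∣ {p = p} {q} refl ∣q∣≡∣p∣ p≢q =
  [ id , subst (_< ∣ p ∪ q ∣) ∣q∣≡∣p∣ ] (p≢q⇒∣p∣<∣p∪q∣⊎∣q∣<∣p∪q∣ p q p≢q)

disjoint-pairs⇒2k+2≤n : ∀ {n k} {a b c d : Subset n} →
  ∣ a ∣ ≡ k → ∣ b ∣ ≡ k → ∣ c ∣ ≡ k → ∣ d ∣ ≡ k → a ≢ b → c ≢ d →
  Empty (a ∩ c) → Empty (a ∩ d) → Empty (b ∩ c) → Empty (b ∩ d) → 2 * k + 2 ≤ n
disjoint-pairs⇒2k+2≤n {n} {k} {a} {b} {c} {d} ∣a∣ ∣b∣ ∣c∣ ∣d∣ a≢b c≢d ac ad bc bd = begin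
  2 * k + 2                  ≡⟨ 2k+2≡1+k+1+k k ⟩
  suc k + suc k              ≤⟨ +-mono-≤ (p≢q⇒k<∣p∪q∣ ∣a∣ ∣b∣ a≢b) (p≢q⇒k<∣p∪q∣ ∣c∣ ∣d∣ c≢d) ⟩
  ∣ a ∪ b ∣ + ∣ c ∪ d ∣      ≡⟨ Empty-∩⇒∣p∪q∣≡∣p∣+∣q∣ (a ∪ b) (c ∪ d) ab∩cd-empty ⟨
  ∣ (a ∪ b) ∪ (c ∪ d) ∣      ≤⟨ ∣p∣≤n ((a ∪ b) ∪ (c ∪ d)) ⟩
  n                          ∎
  where
  open ≤-Reasoning
  ab∩cd-empty : Empty ((a ∪ b) ∩ (c ∪ d))
  ab∩cd-empty = Empty-[p∪q]∩r (Empty-p∩[q∪r] ac ad) (Empty-p∩[q∪r] bc bd)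
  2k+2≡1+k+1+k : ∀ k → 2 * k + 2 ≡ suc k + suc k
  2k+2≡1+k+1+k = solve-∀

module _ {n k : ℕ} where

  subset : V (KG n k) × Fin 2 → Subset n
  subset x = proj₁ (proj₁ x)

  IncAdj-KG-disjoint : ∀ {x y} → IncAdj (KG n k) x y → Empty (subset x ∩ subset y)
  IncAdj-KG-disjoint (inc01 p∩q-empty) = p∩q-empty
  IncAdj-KG-disjoint (inc10 p∩q-empty) = subst Empty (∩-comm _ _) p∩q-empty

  KG-element-≡ : ∀ {x y} → subset x ≡ subset y → proj₂ x ≡ proj₂ y → x ≡ y
  KG-element-≡ {(p , ∣p∣≡k) , t} {(.p , ∣p∣≡k′) , .t} refl refl
    rewrite ≡-irrelevant ∣p∣≡k ∣p∣≡k′ = refl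

  KG-4-cycle⇒2k+2≤n : Cycle (IncidenceGraph (KG n k)) 4 → 2 * k + 2 ≤ n
  KG-4-cycle⇒2k+2≤n record { len = refl ; c = c ; inj = inj ; step = step ; close = close } =
    disjoint-pairs⇒2k+2≤n (size (c 0F)) (size (c 2F)) (size (c 1F)) (size (c 3F))
      (distinct (λ ()) (IncAdj-IncAdj-same-type (step 0F) (step 1F)))
      (distinct (λ ()) (IncAdj-IncAdj-same-type (step 1F) (step 2F)))
      (IncAdj-KG-disjoint (step 0F))
      (IncAdj-KG-disjoint (IncAdj-sym close))
      (IncAdj-KG-disjoint (IncAdj-sym (step 1F)))
      (IncAdj-KG-disjoint (step 2F))
    where
    size : (x : V (KG n k) × Fin 2) → ∣ subset x ∣ ≡ k
    size x = proj₂ (proj₁ x)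
    distinct : ∀ {i j} → i ≢ j → proj₂ (c j) ≡ proj₂ (c i) → subset (c i) ≢ subset (c j)
    distinct i≢j same-type same-set = i≢j (inj (KG-element-≡ same-set (sym same-type)))

record DisjointPair (m j : ℕ) : Set where
  field
    S T       : Subset m
    ∣S∣≡j     : ∣ S ∣ ≡ j
    ∣T∣≡j     : ∣ T ∣ ≡ j
    S∩T-empty : Empty (S ∩ T)

disjoint-pair : ∀ j {m} → j + j ≤ m → DisjointPair m j
disjoint-pair zero {m} _ = record
  { S = ⊥ ; T = ⊥ ; ∣S∣≡j = ∣⊥∣≡0 m ; ∣T∣≡j = ∣⊥∣≡0 m
  ; S∩T-empty = λ (x , x∈⊥∩⊥) → ∉⊥ (proj₁ (x∈p∩q⁻ ⊥ ⊥ x∈⊥∩⊥)) }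
disjoint-pair (suc j) {m} le with subst (_≤ m) (cong suc (+-suc j j)) le
... | s≤s (s≤s j+j≤m) = record
  { S = true ∷ false ∷ S ; T = false ∷ true ∷ T
  ; ∣S∣≡j = cong suc ∣S∣≡j ; ∣T∣≡j = cong suc ∣T∣≡j
  ; S∩T-empty = Empty-∷ (Empty-∷ S∩T-empty) }
  where open DisjointPair (disjoint-pair j j+j≤m)

module Hexagon {m j : ℕ} (D : DisjointPair m j) where
  open DisjointPair D

  Element : Set
  Element = V (KG (3 + m) (suc j)) × Fin 2

  p₀ p₁ p₂ q₀ q₁ q₂ : V (KG (3 + m) (suc j))
  p₀ = (true  ∷ false ∷ false ∷ S) , cong suc ∣S∣≡j
  p₁ = (false ∷ true  ∷ false ∷ S) , cong suc ∣S∣≡j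
  p₂ = (false ∷ false ∷ true  ∷ S) , cong suc ∣S∣≡j
  q₀ = (false ∷ false ∷ true  ∷ T) , cong suc ∣T∣≡j
  q₁ = (true  ∷ false ∷ false ∷ T) , cong suc ∣T∣≡j
  q₂ = (false ∷ true  ∷ false ∷ T) , cong suc ∣T∣≡j

  apart : Empty (false ∷ false ∷ false ∷ (S ∩ T))
  apart = Empty-∷ (Empty-∷ (Empty-∷ S∩T-empty))

  c : Fin 6 → Element
  c 0F = p₀ , 0F
  c 1F = q₀ , 1F
  c 2F = p₁ , 0F
  c 3F = q₁ , 1F
  c 4F = p₂ , 0F
  c 5F = q₂ , 1F

  position : Element → Fin 6
  position (((true  ∷ _     ∷ _ ∷ _) , _) , 0F)    = 0F
  position (((false ∷ true  ∷ _ ∷ _) , _) , 0F)    = 2F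
  position (((false ∷ false ∷ _ ∷ _) , _) , 0F)    = 4F
  position (((false ∷ false ∷ _ ∷ _) , _) , suc _) = 1F
  position (((true  ∷ _     ∷ _ ∷ _) , _) , suc _) = 3F
  position (((false ∷ true  ∷ _ ∷ _) , _) , suc _) = 5F

  position-c : ∀ i → position (c i) ≡ i
  position-c 0F = refl
  position-c 1F = refl
  position-c 2F = refl
  position-c 3F = refl
  position-c 4F = refl
  position-c 5F = refl

  step : (i : Fin 5) → IncAdj (KG (3 + m) (suc j)) (c (inject₁ i)) (c (suc i))
  step 0F = inc01 apart
  step 1F = inc10 apart
  step 2F = inc01 apart
  step 3F = inc10 apart
  step 4F = inc01 apart

  cycle : Cycle (IncidenceGraph (KG (3 + m) (suc j))) 6
  cycle = record
    { l = 5 ; len = refl ; atLeast3 = m≤m+n 3 3 ; c = c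
    ; inj = inverseʳ⇒injective c (strictlyInverseʳ⇒inverseʳ {f⁻¹ = position} c position-c)
    ; step = step ; close = inc10 apart }

module Square {m j : ℕ} (D : DisjointPair m j) where
  open DisjointPair D

  Element : Set
  Element = V (KG (4 + m) (suc j)) × Fin 2

  p₀ p₁ q₀ q₁ : V (KG (4 + m) (suc j))
  p₀ = (true  ∷ false ∷ false ∷ false ∷ S) , cong suc ∣S∣≡j
  p₁ = (false ∷ true  ∷ false ∷ false ∷ S) , cong suc ∣S∣≡j
  q₀ = (false ∷ false ∷ true  ∷ false ∷ T) , cong suc ∣T∣≡j
  q₁ = (false ∷ false ∷ false ∷ true  ∷ T) , cong suc ∣T∣≡j

  apart : Empty (false ∷ false ∷ false ∷ false ∷ (S ∩ T))
  apart = Empty-∷ (Empty-∷ (Empty-∷ (Empty-∷ S∩T-empty)))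

  c : Fin 4 → Element
  c 0F = p₀ , 0F
  c 1F = q₀ , 1F
  c 2F = p₁ , 0F
  c 3F = q₁ , 1F

  position : Element → Fin 4
  position (((true  ∷ _ ∷ _     ∷ _) , _) , 0F)    = 0F
  position (((false ∷ _ ∷ _     ∷ _) , _) , 0F)    = 2F
  position (((_     ∷ _ ∷ true  ∷ _) , _) , suc _) = 1F
  position (((_     ∷ _ ∷ false ∷ _) , _) , suc _) = 3F

  position-c : ∀ i → position (c i) ≡ i
  position-c 0F = refl
  position-c 1F = refl
  position-c 2F = refl
  position-c 3F = refl

  step : (i : Fin 3) → IncAdj (KG (4 + m) (suc j)) (c (inject₁ i)) (c (suc i))
  step 0F = inc01 apart
  step 1F = inc10 apart
  step 2F = inc01 apart

  cycle : Cycle (IncidenceGraph (KG (4 + m) (suc j))) 4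
  cycle = record
    { l = 3 ; len = refl ; atLeast3 = m≤m+n 3 1 ; c = c
    ; inj = inverseʳ⇒injective c (strictlyInverseʳ⇒inverseʳ {f⁻¹ = position} c position-c)
    ; step = step ; close = inc10 apart }

ground-set-split : ∀ {j n} c → 2 * suc j + c ≤ n → Σ ℕ λ m → j + j ≤ m × (c + 2) + m ≡ n
ground-set-split {j} c le with m≤n⇒∃[o]m+o≡n le
... | o , e = j + j + o , m≤m+n (j + j) o , trans (rearrange j c o) e
  where
  rearrange : ∀ j c o → (c + 2) + (j + j + o) ≡ 2 * suc j + c + o
  rearrange = solve-∀

KG-hexagon : ∀ {n k} → 1 ≤ k → 2 * k + 1 ≤ n → Cycle (IncidenceGraph (KG n k)) 6
KG-hexagon {k = suc j} _ le with ground-set-split 1 le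
... | m , j+j≤m , refl = Hexagon.cycle (disjoint-pair j j+j≤m)

KG-square : ∀ {n k} → 1 ≤ k → 2 * k + 2 ≤ n → Cycle (IncidenceGraph (KG n k)) 4
KG-square {k = suc j} _ le with ground-set-split 2 le
... | m , j+j≤m , refl = Square.cycle (disjoint-pair j j+j≤m)

lemma3p2 : (k n : ℕ) → 1 ≤ k → 2 * k + 1 ≤ n →
    (n ≡ 2 * k + 1 → HasGonality (KG n k) 3) ×
    (2 * k + 2 ≤ n → HasGonality (KG n k) 2)
lemma3p2 k n 1≤k _ = gonality-3 , gonality-2
  where
  gonality-3 : n ≡ 2 * k + 1 → HasGonality (KG n k) 3
  gonality-3 refl = KG-hexagon 1≤k ≤-refl , λ _ → incidence-girth≥6 no-square
    where
    no-square : ¬ Cycle (IncidenceGraph (KG (2 * k + 1) k)) 4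
    no-square C with +-cancelˡ-≤ (2 * k) 2 1 (KG-4-cycle⇒2k+2≤n C)
    ... | s≤s ()

  gonality-2 : 2 * k + 2 ≤ n → HasGonality (KG n k) 2
  gonality-2 2k+2≤n = KG-square 1≤k 2k+2≤n , λ _ → incidence-girth≥4
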